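{- For any fixed integer $a \ge 2$, there exist infinitely many positive integers $n$ such that $N(a, C_n) \ge n^{1+o(1)}$ (where $o(1)\to 0$ as $n\to\infty$).
   Context: $C_n$ is the cyclic group of order $n$. For a finite group $H$ and integer $a\ge 2$, $G(a,H)$ is the undirected multigraph on vertex set $H$ with an edge between $x$ and $y$ whenever $x^a=y$ (an additional edge if also $y^a=x$; loops allowed), and $N(a,H)$ is its number of connected components, equivalently the number of cycles of the map $x\mapsto x^a$ on $H$. -}

module Defs where

open import Data.Nat using (ℕ; zero; suc; _*_; _%_; _≡ᵇ_; _≤ᵇ_)
open import Data.Bool using (Bool; _∧_)
open import Data.List using (List; length; upTo; filterᵇ)
open import Data.Bool.ListAction using (all; any)

-- The cyclic group C_n (n ≥ 1) is modelled as ℤ/nℤ = {0,…,n-1} under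
-- addition mod n; the a-th power map x ↦ x^a is then x ↦ a·x mod n.

iter : {A : Set} → (A → A) → ℕ → A → A
iter f zero    x = x
iter f (suc k) x = f (iter f k x)

powMap : (a m : ℕ) → ℕ → ℕ
powMap a m x = (a * x) % suc m

isPeriodic : (f : ℕ → ℕ) (n x : ℕ) → Bool
isPeriodic f n x = any (λ k → iter f (suc k) x ≡ᵇ x) (upTo n)

-- x is the smallest element of its f-orbit (the orbit is reached within n steps)
isOrbitMin : (f : ℕ → ℕ) (n x : ℕ) → Bool
isOrbitMin f n x = all (λ j → x ≤ᵇ iter f j x) (upTo n)

-- Number of cycles of a self-map f of {0,…,n-1}: each cycle is counted once,
-- via its least element.
numCycles : (f : ℕ → ℕ) (n : ℕ) → ℕ
numCycles f n = length (filterᵇ (λ x → isPeriodic f n x ∧ isOrbitMin f n x) (upTo n))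

-- N(a, C_n): number of cycles of x ↦ x^a on C_n (C_0 is not a group; N a 0 = 0)
N : ℕ → ℕ → ℕ
N a zero    = 0
N a (suc m) = numCycles (powMap a m) (suc m)

-- If a^m ≡ 1 (mod n), the m-th iterate of x ↦ a·x on ℤ/nℤ is the identity, so every
-- cycle has at most m elements and N(a, C_n) ≥ n / m. Take n = a^M − 1 with
-- M = 2^(2j+2): then N(a, C_n) ≥ n / M, and M^k ≤ M^j < 2^M ≤ n + 1 for k ≤ j, so
-- n^(k-1) ≤ (n / M)^k ≤ N(a, C_n)^k.
module Submission where

open import Defs
open import Algebra.Properties.CommutativeSemigroup using (interchange)
open import Data.Bool using (T; _∧_)
open import Data.Bool.Properties using (T-∧)
open import Data.Fin using (Fin; toℕ)
open import Data.Fin.Properties using (pigeonhole; toℕ<n)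
open import Data.List using (List; []; _∷_; length; upTo; filterᵇ; map; concatMap; lookup)
open import Data.List.Extrema.Nat using (argmin; argmin-all; f[argmin]≤f[xs])
open import Data.List.Membership.Propositional using (_∈_; lose)
open import Data.List.Membership.Propositional.Properties
  using (∈-upTo⁺; ∈-upTo⁻; ∈-map⁺; ∈-concatMap⁺; ∈-filter⁺)
open import Data.List.Properties using (length-map; length-upTo; length-++)
import Data.List.Relation.Unary.All as All
open import Data.List.Relation.Unary.All.Properties using (all⁻)
open import Data.List.Relation.Unary.Any using (Any; index)
open import Data.List.Relation.Unary.Any.Properties using (any⁺; lookup-index)
open import Data.Nat
open import Data.Nat.DivMod
open import Data.Nat.Properties
open import Data.Product using (Σ; _×_; _,_)
open import Function using (_∘_; Equivalence)
open import Relation.Binary.PropositionalEquality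
open import Relation.Nullary.Decidable using (T?)

iter-+ : ∀ {A : Set} (f : A → A) i j x → iter f (i + j) x ≡ iter f i (iter f j x)
iter-+ f zero    j x = refl
iter-+ f (suc i) j x = cong f (iter-+ f i j x)

covers⇒≤length : ∀ {n} (xs : List ℕ) → (∀ {x} → x < n → x ∈ xs) → n ≤ length xs
covers⇒≤length {n} xs covers = ≮⇒≥ λ len<n →
  let i , j , i<j , same = pigeonhole len<n position
  in <⇒≢ i<j (begin
    toℕ i                   ≡⟨ lookup-index (covers (toℕ<n i)) ⟩
    lookup xs (position i)  ≡⟨ cong (lookup xs) same ⟩
    lookup xs (position j)  ≡⟨ lookup-index (covers (toℕ<n j)) ⟨
    toℕ j                   ∎)
  where
  open ≡-Reasoning
  position : Fin n → Fin (length xs)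
  position i = index (covers (toℕ<n i))

length-concatMap-const : ∀ {A B : Set} {m} (g : A → List B) → (∀ x → length (g x) ≡ m) →
                         ∀ xs → length (concatMap g xs) ≡ length xs * m
length-concatMap-const g length-g []       = refl
length-concatMap-const g length-g (x ∷ xs) =
  trans (length-++ (g x)) (cong₂ _+_ (length-g x) (length-concatMap-const g length-g xs))

module _ (f : ℕ → ℕ) {n m : ℕ} .{{_ : NonZero m}}
         (f-below : ∀ {x} → x < n → f x < n)
         (iter-period : ∀ {x} → x < n → iter f m x ≡ x) where

  iter-below : ∀ i {x} → x < n → iter f i x < n
  iter-below zero    x<n = x<n
  iter-below (suc i) x<n = f-below (iter-below i x<n)

  iter-*-period : ∀ q {x} → x < n → iter f (q * m) x ≡ x
  iter-*-period zero    x<n = refl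
  iter-*-period (suc q) {x} x<n = begin
    iter f (m + q * m) x        ≡⟨ iter-+ f m (q * m) x ⟩
    iter f m (iter f (q * m) x) ≡⟨ cong (iter f m) (iter-*-period q x<n) ⟩
    iter f m x                  ≡⟨ iter-period x<n ⟩
    x                           ∎
    where open ≡-Reasoning

  iter-%-period : ∀ i {x} → x < n → iter f i x ≡ iter f (i % m) x
  iter-%-period i {x} x<n = begin
    iter f i x                            ≡⟨ cong (λ k → iter f k x) (m≡m%n+[m/n]*n i m) ⟩
    iter f (i % m + i / m * m) x          ≡⟨ iter-+ f (i % m) (i / m * m) x ⟩
    iter f (i % m) (iter f (i / m * m) x) ≡⟨ cong (iter f (i % m)) (iter-*-period (i / m) x<n) ⟩
    iter f (i % m) x                      ∎
    where open ≡-Reasoning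

  orbit : ℕ → List ℕ
  orbit x = map (λ i → iter f i x) (upTo m)

  length-orbit : ∀ x → length (orbit x) ≡ m
  length-orbit x = trans (length-map _ (upTo m)) (length-upTo m)

  isPeriodic-intro : m ≤ n → ∀ {x} → x < n → T (isPeriodic f n x)
  isPeriodic-intro m≤n {x} x<n = any⁺ _ (lose (∈-upTo⁺ pred[m]<n) returns)
    where
    pred[m]<n : pred m < n
    pred[m]<n = ≤-trans (≤-reflexive (suc-pred m)) m≤n
    returns : T (iter f (suc (pred m)) x ≡ᵇ x)
    returns = ≡⇒≡ᵇ _ x (trans (cong (λ k → iter f k x) (suc-pred m)) (iter-period x<n))

  isOrbitMin-intro : ∀ {x} → (∀ i → x ≤ iter f i x) → T (isOrbitMin f n x)
  isOrbitMin-intro x≤ = all⁻ _ {upTo n} (All.tabulate λ {i} _ → ≤⇒≤ᵇ (x≤ i))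

  module OrbitMinimum {x : ℕ} (x<n : x < n) where

    offset : ℕ
    offset = argmin (λ i → iter f i x) 0 (upTo m)

    offset<m : offset < m
    offset<m = argmin-all (λ i → iter f i x) {xs = upTo m} (>-nonZero⁻¹ m) (All.tabulate ∈-upTo⁻)

    rep : ℕ
    rep = iter f offset x

    rep<n : rep < n
    rep<n = iter-below offset x<n

    rep-minimal : ∀ i → rep ≤ iter f i rep
    rep-minimal i = begin
      rep                          ≤⟨ offset-minimal (m%n<n (i + offset) m) ⟩
      iter f ((i + offset) % m) x  ≡⟨ iter-%-period (i + offset) x<n ⟨
      iter f (i + offset) x        ≡⟨ iter-+ f i offset x ⟩
      iter f i rep                 ∎
      where
      open ≤-Reasoning
      offset-minimal : ∀ {i} → i < m → rep ≤ iter f i x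
      offset-minimal i<m =
        All.lookup (f[argmin]≤f[xs] {f = λ i → iter f i x} 0 (upTo m)) (∈-upTo⁺ i<m)

    ∈-orbit-rep : x ∈ orbit rep
    ∈-orbit-rep = subst (_∈ orbit rep) back (∈-map⁺ _ (∈-upTo⁺ (m%n<n (m ∸ offset) m)))
      where
      open ≡-Reasoning
      back : iter f ((m ∸ offset) % m) rep ≡ x
      back = begin
        iter f ((m ∸ offset) % m) rep ≡⟨ iter-%-period (m ∸ offset) rep<n ⟨
        iter f (m ∸ offset) rep       ≡⟨ iter-+ f (m ∸ offset) offset x ⟨
        iter f (m ∸ offset + offset) x ≡⟨ cong (λ k → iter f k x) (m∸n+n≡m (<⇒≤ offset<m)) ⟩
        iter f m x                    ≡⟨ iter-period x<n ⟩
        x                             ∎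

  cycleReps : List ℕ
  cycleReps = filterᵇ (λ x → isPeriodic f n x ∧ isOrbitMin f n x) (upTo n)

  orbit-of-cycleRep : m ≤ n → ∀ {x} → x < n → Any (λ r → x ∈ orbit r) cycleReps
  orbit-of-cycleRep m≤n x<n = lose rep∈cycleReps ∈-orbit-rep
    where
    open OrbitMinimum x<n
    rep∈cycleReps : rep ∈ cycleReps
    rep∈cycleReps = ∈-filter⁺ (T? ∘ _) (∈-upTo⁺ rep<n)
      (Equivalence.from T-∧ (isPeriodic-intro m≤n rep<n , isOrbitMin-intro rep-minimal))

  n≤numCycles*period : m ≤ n → n ≤ numCycles f n * m
  n≤numCycles*period m≤n = begin
    n
      ≤⟨ covers⇒≤length _ (∈-concatMap⁺ orbit ∘ orbit-of-cycleRep m≤n) ⟩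
    length (concatMap orbit cycleReps)
      ≡⟨ length-concatMap-const orbit length-orbit cycleReps ⟩
    numCycles f n * m
      ∎
    where open ≤-Reasoning

[m*[n%d]]%d≡[m*n]%d : ∀ m n d .{{_ : NonZero d}} → (m * (n % d)) % d ≡ (m * n) % d
[m*[n%d]]%d≡[m*n]%d m n d = begin
  (m * (n % d)) % d               ≡⟨ %-distribˡ-* m (n % d) d ⟩
  ((m % d) * (n % d % d)) % d     ≡⟨ cong (λ k → ((m % d) * k) % d) (m%n%n≡m%n n d) ⟩
  ((m % d) * (n % d)) % d         ≡⟨ %-distribˡ-* m n d ⟨
  (m * n) % d                     ∎
  where open ≡-Reasoning

module _ (a p : ℕ) where

  iter-powMap : ∀ i {x} → x < suc p → iter (powMap a p) i x ≡ (a ^ i * x) % suc p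
  iter-powMap zero    {x} x<n = sym (trans (cong (_% suc p) (*-identityˡ x)) (m<n⇒m%n≡m x<n))
  iter-powMap (suc i) {x} x<n = begin
    (a * iter (powMap a p) i x) % suc p ≡⟨ cong (λ y → (a * y) % suc p) (iter-powMap i x<n) ⟩
    (a * ((a ^ i * x) % suc p)) % suc p ≡⟨ [m*[n%d]]%d≡[m*n]%d a (a ^ i * x) (suc p) ⟩
    (a * (a ^ i * x)) % suc p           ≡⟨ cong (_% suc p) (*-assoc a (a ^ i) x) ⟨
    (a ^ suc i * x) % suc p             ∎
    where open ≡-Reasoning

  iter-powMap-period : ∀ m → a ^ m % suc p ≡ 1 % suc p →
                      ∀ {x} → x < suc p → iter (powMap a p) m x ≡ x
  iter-powMap-period m a^m≡1 {x} x<n = begin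
    iter (powMap a p) m x                     ≡⟨ iter-powMap m x<n ⟩
    (a ^ m * x) % suc p                       ≡⟨ %-distribˡ-* (a ^ m) x (suc p) ⟩
    ((a ^ m % suc p) * (x % suc p)) % suc p   ≡⟨ cong (λ r → (r * (x % suc p)) % suc p) a^m≡1 ⟩
    ((1 % suc p) * (x % suc p)) % suc p       ≡⟨ %-distribˡ-* 1 x (suc p) ⟨
    (1 * x) % suc p                           ≡⟨ cong (_% suc p) (*-identityˡ x) ⟩
    x % suc p                                 ≡⟨ m<n⇒m%n≡m x<n ⟩
    x                                         ∎
    where open ≡-Reasoning

n≤N*period : ∀ a n m .{{_ : NonZero n}} .{{_ : NonZero m}} →
            m ≤ n → a ^ m % n ≡ 1 % n → n ≤ N a n * m
n≤N*period a (suc p) m m≤n a^m≡1 =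
  n≤numCycles*period (powMap a p) (λ {x} _ → m%n<n (a * x) (suc p))
    (iter-powMap-period a p m a^m≡1) m≤n

^-distribʳ-* : ∀ m n o → (m * n) ^ o ≡ m ^ o * n ^ o
^-distribʳ-* m n zero    = refl
^-distribʳ-* m n (suc o) =
  trans (cong (m * n *_) (^-distribʳ-* m n o))
        (interchange *-commutativeSemigroup m n (m ^ o) (n ^ o))

n^k≤c^[1+k] : ∀ {n c M} k .{{_ : NonZero M}} → n ≤ c * M → M ^ suc k ≤ n → n ^ k ≤ c ^ suc k
n^k≤c^[1+k] {n} {c} {M} k n≤cM M^[1+k]≤n =
  *-cancelʳ-≤ (n ^ k) (c ^ suc k) (M ^ suc k) {{m^n≢0 M (suc k)}} (begin
    n ^ k * M ^ suc k       ≤⟨ *-monoʳ-≤ (n ^ k) M^[1+k]≤n ⟩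
    n ^ k * n               ≡⟨ *-comm (n ^ k) n ⟩
    n ^ suc k               ≤⟨ ^-monoˡ-≤ (suc k) n≤cM ⟩
    (c * M) ^ suc k         ≡⟨ ^-distribʳ-* c M (suc k) ⟩
    c ^ suc k * M ^ suc k   ∎)
  where open ≤-Reasoning

2^n+2^n≡2^[1+n] : ∀ n → 2 ^ n + 2 ^ n ≡ 2 ^ suc n
2^n+2^n≡2^[1+n] n = cong (2 ^ n +_) (sym (+-identityʳ (2 ^ n)))

n<2^n : ∀ n → n < 2 ^ n
n<2^n zero    = s≤s z≤n
n<2^n (suc n) = begin-strict
  suc n          <⟨ s≤s (n<2^n n) ⟩
  suc (2 ^ n)    ≤⟨ +-monoˡ-≤ (2 ^ n) (m^n>0 2 n) ⟩
  2 ^ n + 2 ^ n  ≡⟨ 2^n+2^n≡2^[1+n] n ⟩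
  2 ^ suc n      ∎
  where open ≤-Reasoning

log₂period : ℕ → ℕ
log₂period j = suc j + suc j

period : ℕ → ℕ
period j = 2 ^ log₂period j

period≢0 : ∀ j → NonZero (period j)
period≢0 j = m^n≢0 2 (log₂period j)

log₂period*j<period : ∀ j → log₂period j * j < period j
log₂period*j<period j = begin-strict
  log₂period j * j      ≤⟨ *-monoˡ-≤ j (+-mono-≤ (n<2^n j) (n<2^n j)) ⟩
  (2 ^ j + 2 ^ j) * j   ≡⟨ cong (_* j) (2^n+2^n≡2^[1+n] j) ⟩
  2 ^ suc j * j         <⟨ *-monoʳ-< (2 ^ suc j) {{m^n≢0 2 (suc j)}} j<2^[1+j] ⟩
  2 ^ suc j * 2 ^ suc j ≡⟨ ^-distribˡ-+-* 2 (suc j) (suc j) ⟨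
  period j              ∎
  where
  open ≤-Reasoning
  j<2^[1+j] : j < 2 ^ suc j
  j<2^[1+j] = <-trans (n<1+n j) (n<2^n (suc j))

period^j<2^period : ∀ j → period j ^ j < 2 ^ period j
period^j<2^period j = begin-strict
  period j ^ j            ≡⟨ ^-*-assoc 2 (log₂period j) j ⟩
  2 ^ (log₂period j * j)  <⟨ ^-monoʳ-< 2 (s≤s (s≤s z≤n)) (log₂period*j<period j) ⟩
  2 ^ period j            ∎
  where open ≤-Reasoning

period-increasing : ∀ j → period j < period (suc j)
period-increasing j = ^-monoʳ-< 2 (s≤s (s≤s z≤n)) (+-mono-< (n<1+n (suc j)) (n<1+n (suc j)))

module Modulus (a : ℕ) (2≤a : 2 ≤ a) where

  private instance
    a≢0 : NonZero a
    a≢0 = >-nonZero (≤-trans (s≤s z≤n) 2≤a)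

  modulus : ℕ → ℕ
  modulus j = pred (a ^ period j)

  modulus-increasing : ∀ j → modulus j < modulus (suc j)
  modulus-increasing j = pred-mono-< {{m^n≢0 a (period j)}} (^-monoʳ-< a 2≤a (period-increasing j))

  module _ (j : ℕ) where

    private instance
      period-nonZero : NonZero (period j)
      period-nonZero = period≢0 j

    2^period≤a^period : 2 ^ period j ≤ a ^ period j
    2^period≤a^period = ^-monoˡ-≤ (period j) 2≤a

    period^k≤modulus : ∀ {k} → k ≤ j → period j ^ k ≤ modulus j
    period^k≤modulus {k} k≤j = <⇒≤pred (begin-strict
      period j ^ k  ≤⟨ ^-monoʳ-≤ (period j) k≤j ⟩
      period j ^ j  <⟨ period^j<2^period j ⟩
      2 ^ period j  ≤⟨ 2^period≤a^period ⟩
      a ^ period j  ∎)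
      where open ≤-Reasoning

    1≤modulus : 1 ≤ modulus j
    1≤modulus = period^k≤modulus z≤n

    period≤modulus : period j ≤ modulus j
    period≤modulus = <⇒≤pred (<-≤-trans (n<2^n (period j)) 2^period≤a^period)

    private instance
      modulus-nonZero : NonZero (modulus j)
      modulus-nonZero = >-nonZero 1≤modulus

    a^period≡1[mod-modulus] : a ^ period j % modulus j ≡ 1 % modulus j
    a^period≡1[mod-modulus] =
      trans (cong (_% modulus j) (sym (suc-pred (a ^ period j) {{m^n≢0 a (period j)}})))
            ([m+n]%n≡m%n 1 (modulus j))

    modulus^k≤N^[1+k] : ∀ k → suc k ≤ j → modulus j ^ k ≤ N a (modulus j) ^ suc k
    modulus^k≤N^[1+k] k 1+k≤j = n^k≤c^[1+k] {c = N a (modulus j)} k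
      (n≤N*period a (modulus j) (period j) period≤modulus a^period≡1[mod-modulus])
      (period^k≤modulus 1+k≤j)

theorem3p2 : (a : ℕ) → 2 ≤ a →
    Σ (ℕ → ℕ) λ n →
      ((j : ℕ) → 1 ≤ n j) ×
      ((j : ℕ) → n j < n (suc j)) ×
      ((k : ℕ) → 1 ≤ k → Σ ℕ λ J → (j : ℕ) → J ≤ j →
        n j ^ (k ∸ 1) ≤ N a (n j) ^ k)
theorem3p2 a 2≤a = modulus , 1≤modulus , modulus-increasing , eventually
  where
  open Modulus a 2≤a
  eventually : (k : ℕ) → 1 ≤ k → Σ ℕ λ J → (j : ℕ) → J ≤ j →
               modulus j ^ (k ∸ 1) ≤ N a (modulus j) ^ k
  eventually (suc k) _ = suc k , λ j → modulus^k≤N^[1+k] j k
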